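{- For every finite set $\Gamma$ of formulae and every formula $\phi$ of intuitionistic propositional logic, $\Gamma\Vdash\phi$ (Sandqvist base-extension validity) holds if and only if $\Gamma\models\phi$ (there is a natural transformation $\llbracket\Gamma\rrbracket\to\llbracket\phi\rrbracket$ of presheaves on $\mathcal W$).
   Context: Fix a countable set $\mathbb A$ of atoms; formulae are built from atoms and $\bot$ with $\wedge,\vee,\supset$. An atomic rule is $\mathcal R=((P_1\Rightarrow q_1),\dots,(P_n\Rightarrow q_n))\Rightarrow r$ with $n\ge0$, $P_i$ finite sets of atoms, $q_i,r$ atoms. A base is a countable set of atomic rules. For a base $\mathcal B$, atomic consequence $P\vdash_{\mathcal B}p$ ($P$ a set of atoms) is the least relation with (Ref) $P,p\vdash_{\mathcal B}p$ and (App) if $\mathcal R\in\mathcal B$ and $P,P_i\vdash_{\mathcal B}q_i$ for all $i$ then $P\vdash_{\mathcal B}r$. Validity in a base: $\Vdash_{\mathcal B}p$ iff $\emptyset\vdash_{\mathcal B}p$; $\Vdash_{\mathcal B}\phi\supset\psi$ iff $\phi\Vdash_{\mathcal B}\psi$; $\Vdash_{\mathcal B}\phi\wedge\psi$ iff $\Vdash_{\mathcal B}\phi$ and $\Vdash_{\mathcal B}\psi$; $\Vdash_{\mathcal B}\phi\vee\psi$ iff for every atom $p$ and every base $\mathcal C\supseteq\mathcal B$, if $\phi\Vdash_{\mathcal C}p$ and $\psi\Vdash_{\mathcal C}p$ then $\Vdash_{\mathcal C}p$; $\Vdash_{\mathcal B}\bot$ iff $\Vdash_{\mathcal B}p$ for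 all atoms $p$; and for nonempty $\Theta$, $\Theta\Vdash_{\mathcal B}\phi$ iff for every $\mathcal C\supseteq\mathcal B$, if $\Vdash_{\mathcal C}\theta$ for all $\theta\in\Theta$ then $\Vdash_{\mathcal C}\phi$. $\Gamma\Vdash\phi$ means: for all bases $\mathcal B$, if $\Vdash_{\mathcal B}\psi$ for all $\psi\in\Gamma$ then $\Vdash_{\mathcal B}\phi$. Proof terms: a context $(X:P)$ is a finite list $x_1:p_1,\dots,x_m:p_m$; derivation terms $\Phi::=x\mid\Phi_{\mathcal R}(\Phi_1,\dots,\Phi_n)$ with judgements generated by $(X:P),x:p\vdash_{\mathcal B}x:p$ and, for $\mathcal R\in\mathcal B$, from $(X:P),(X_i:P_i)\vdash_{\mathcal B}\Phi_i:q_i$ ($i=1..n$) infer $(X:P)\vdash_{\mathcal B}\Phi_{\mathcal R}(\Phi_1,\dots,\Phi_n):r$. The category $\mathcal W$ has objects $(\mathcal B,(X:P))$; a morphism $(\mathcal B,(X:P))\to(\mathcal C,(Y:Q))$, $Y:Q=y_1:q_1,\dots,y_m:q_m$, exists only when $\mathcal C\subseteq\mathcal B$ and is a tuple of derivations $(X:P)\vdash_{\mathcal B}\Phi_i:q_i$; identities are variable tuples, composition is simultaneous substitution. For presheaves $F,G$ on $\mathcal W$: $F\times G$ pointwise; $(F\supset G)(w)$ = natural transformations $\mathcal W(-,w)\times F\to G$. Interpretation: $\llbracket p\rrbracket(\mathcal B,(X:P))$ = set of derivations $(X:P)\vdash_{\mathcal B}\Phi:p$ with action by substitution; $\llbracket\phi\wedge\psi\rrbracket=\llbracket\phi\rrbracket\times\llbracket\psi\rrbracket$;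 $\llbracket\phi\supset\psi\rrbracket=\llbracket\phi\rrbracket\supset\llbracket\psi\rrbracket$; $\llbracket\phi\vee\psi\rrbracket=\prod_{p\in\mathbb A}\big((\llbracket\phi\rrbracket\supset\llbracket p\rrbracket)\supset((\llbracket\psi\rrbracket\supset\llbracket p\rrbracket)\supset\llbracket p\rrbracket)\big)$; $\llbracket\bot\rrbracket=\prod_{p\in\mathbb A}\llbracket p\rrbracket$; $\llbracket\Gamma\rrbracket$ = product over $\Gamma$ (terminal if empty). -}

module Defs where

open import Level using (Level; Lift; lift; lower) renaming (zero to lzero; suc to lsuc)
open import Data.Nat using (ℕ)
open import Data.Unit.Polymorphic using (⊤; tt)
open import Data.Product using (_×_; _,_; proj₁; proj₂)
open import Data.Sum using (_⊎_; inj₁; inj₂)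
open import Data.List using (List; []; _∷_; _++_)
open import Data.List.Relation.Unary.Any using (here; there)
open import Data.List.Membership.Propositional using (_∈_)
open import Data.List.Relation.Unary.All as All using (All; []; _∷_)
open import Relation.Binary.PropositionalEquality
  using (_≡_; refl; sym; trans; cong; cong₂; subst)

Atom : Set
Atom = ℕ

infixr 6 _∧′_
infixr 5 _∨′_
infixr 4 _⊃′_

data Formula : Set where
  atom : Atom → Formula
  ⊥′   : Formula
  _∧′_ : Formula → Formula → Formula
  _∨′_ : Formula → Formula → Formula
  _⊃′_ : Formula → Formula → Formula

-- ((P₁ ⇒ q₁), …, (Pₙ ⇒ qₙ)) ⇒ r ; the finite sets Pᵢ are given as lists
record Rule : Set where
  constructor _⇒_
  field
    premises   : List (List Atom × Atom)
    conclusion : Atom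
open Rule public

Base : Set₁
Base = Rule → Set

_⊆_ : Base → Base → Set
B ⊆ C = ∀ R → B R → C R

data _⊢[_]_ (P : List Atom) (B : Base) : Atom → Set where
  Ref : ∀ {p} → p ∈ P → P ⊢[ B ] p
  App : ∀ R → B R →
        All (λ Pq → (P ++ proj₁ Pq) ⊢[ B ] proj₂ Pq) (premises R) →
        P ⊢[ B ] conclusion R

-- Base-extension validity (Sandqvist)

⊩[_]_ : Base → Formula → Set₁
⊩[ B ] atom p  = Lift _ ([] ⊢[ B ] p)
⊩[ B ] ⊥′      = ∀ p → ⊩[ B ] atom p
⊩[ B ] (φ ∧′ ψ) = (⊩[ B ] φ) × (⊩[ B ] ψ)
⊩[ B ] (φ ∨′ ψ) = ∀ (p : Atom) (C : Base) → B ⊆ C →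
                   (∀ (D : Base) → C ⊆ D → ⊩[ D ] φ → ⊩[ D ] atom p) →
                   (∀ (D : Base) → C ⊆ D → ⊩[ D ] ψ → ⊩[ D ] atom p) →
                   ⊩[ C ] atom p
⊩[ B ] (φ ⊃′ ψ) = ∀ (C : Base) → B ⊆ C → ⊩[ C ] φ → ⊩[ C ] ψ
-- (the clauses for ∨ and ⊃ unfold  φ ⊩_C ψ  for the one-element context:
--  ∀ D ⊇ C, ⊩_D φ → ⊩_D ψ)

_⊩_ : List Formula → Formula → Set₁
Γ ⊩ φ = ∀ (B : Base) → All (⊩[ B ]_) Γ → ⊩[ B ] φ

-- Derivation terms.  A context (X:P) is a list of atoms; variables are
-- positions (de Bruijn), x : p ∈ P.  Membership of the rule in the base
-- is irrelevant (it is not part of the term).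

data Der (B : Base) (Γ : List Atom) : Atom → Set
data Ders (B : Base) (Γ : List Atom) : List (List Atom × Atom) → Set

data Der B Γ where
  var : ∀ {p} → p ∈ Γ → Der B Γ p
  app : ∀ R → .(B R) → Ders B Γ (premises R) → Der B Γ (conclusion R)

data Ders B Γ where
  []  : Ders B Γ []
  _∷_ : ∀ {P q Ps} → Der B (Γ ++ P) q → Ders B Γ Ps → Ders B Γ ((P , q) ∷ Ps)

inl : ∀ {A : Set} {p : A} {Γ P} → p ∈ Γ → p ∈ Γ ++ P
inl (here e)  = here e
inl (there x) = there (inl x)

inr : ∀ {A : Set} {p : A} Γ {P} → p ∈ P → p ∈ Γ ++ P
inr []      y = y
inr (q ∷ Γ) y = there (inr Γ y)

case++ : ∀ {A : Set} {p : A} Γ {P} → p ∈ Γ ++ P → p ∈ Γ ⊎ p ∈ P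
case++ []      x         = inj₂ x
case++ (q ∷ Γ) (here e)  = inj₁ (here e)
case++ (q ∷ Γ) (there x) with case++ Γ x
... | inj₁ y = inj₁ (there y)
... | inj₂ y = inj₂ y

case-inl : ∀ {A : Set} {p : A} Γ {P} (x : p ∈ Γ) → case++ Γ {P} (inl x) ≡ inj₁ x
case-inl (q ∷ Γ) (here e) = refl
case-inl (q ∷ Γ) {P} (there x) rewrite case-inl Γ {P} x = refl

case-inr : ∀ {A : Set} {p : A} Γ {P} (y : p ∈ P) → case++ Γ (inr Γ y) ≡ inj₂ y
case-inr []      y = refl
case-inr (q ∷ Γ) y rewrite case-inr Γ y = refl

Ren : List Atom → List Atom → Set
Ren Γ Δ = ∀ {p} → p ∈ Γ → p ∈ Δ

Sb : Base → List Atom → List Atom → Set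
Sb B Γ Δ = ∀ {p} → p ∈ Γ → Der B Δ p

ren⊎ : ∀ {Γ Δ} P → Ren Γ Δ → ∀ {p} → p ∈ Γ ⊎ p ∈ P → p ∈ Δ ++ P
ren⊎ P ρ (inj₁ y) = inl (ρ y)
ren⊎ {Δ = Δ} P ρ (inj₂ y) = inr Δ y

ext-ren : ∀ {Γ Δ} P → Ren Γ Δ → Ren (Γ ++ P) (Δ ++ P)
ext-ren {Γ} P ρ x = ren⊎ P ρ (case++ Γ x)

ren  : ∀ {B Γ Δ p} → Ren Γ Δ → Der B Γ p → Der B Δ p
rens : ∀ {B Γ Δ Ps} → Ren Γ Δ → Ders B Γ Ps → Ders B Δ Ps
ren ρ (var x)      = var (ρ x)
ren ρ (app R m ds) = app R m (rens ρ ds)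
rens ρ []                 = []
rens ρ (_∷_ {P = P} d ds) = ren (ext-ren P ρ) d ∷ rens ρ ds

weaken : ∀ {B Δ P p} → Der B Δ p → Der B (Δ ++ P) p
weaken = ren inl

sub⊎ : ∀ {B Γ Δ} P → Sb B Γ Δ → ∀ {p} → p ∈ Γ ⊎ p ∈ P → Der B (Δ ++ P) p
sub⊎ P σ (inj₁ y) = weaken (σ y)
sub⊎ {Δ = Δ} P σ (inj₂ y) = var (inr Δ y)

ext-sub : ∀ {B Γ Δ} P → Sb B Γ Δ → Sb B (Γ ++ P) (Δ ++ P)
ext-sub {Γ = Γ} P σ x = sub⊎ P σ (case++ Γ x)

sub  : ∀ {B C Γ Δ p} → .(B ⊆ C) → Sb C Γ Δ → Der B Γ p → Der C Δ p
subs : ∀ {B C Γ Δ Ps} → .(B ⊆ C) → Sb C Γ Δ → Ders B Γ Ps → Ders C Δ Ps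
sub i σ (var x)      = σ x
sub i σ (app R m ds) = app R (i R m) (subs i σ ds)
subs i σ []                 = []
subs i σ (_∷_ {P = P} d ds) = sub i (ext-sub P σ) d ∷ subs i σ ds

-- Substitution lemmas (needed to show that composition in 𝒲 is
-- associative, which the exponential of presheaves requires)

_≗_ : ∀ {Γ} {F : Atom → Set} (f g : ∀ {p} → p ∈ Γ → F p) → Set
f ≗ g = ∀ {p} x → f {p} x ≡ g {p} x

ext-ren-cong : ∀ {Γ Δ} P {ρ ρ' : Ren Γ Δ} → (∀ {p} (x : p ∈ Γ) → ρ x ≡ ρ' x) →
               ∀ {p} (x : p ∈ Γ ++ P) → ext-ren P ρ x ≡ ext-ren P ρ' x
ext-ren-cong {Γ} P e x with case++ Γ {P} x
... | inj₁ y = cong inl (e y)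
... | inj₂ y = refl

ren-cong  : ∀ {B Γ Δ p} {ρ ρ' : Ren Γ Δ} → (∀ {q} (x : q ∈ Γ) → ρ x ≡ ρ' x) →
            (d : Der B Γ p) → ren ρ d ≡ ren ρ' d
rens-cong : ∀ {B Γ Δ Ps} {ρ ρ' : Ren Γ Δ} → (∀ {q} (x : q ∈ Γ) → ρ x ≡ ρ' x) →
            (ds : Ders B Γ Ps) → rens ρ ds ≡ rens ρ' ds
ren-cong e (var x) = cong var (e x)
ren-cong e (app R m ds) = cong (app R m) (rens-cong e ds)
rens-cong e [] = refl
rens-cong e (_∷_ {P = P} d ds) = cong₂ _∷_ (ren-cong (ext-ren-cong P e) d) (rens-cong e ds)

ext-sub-cong : ∀ {B Γ Δ} P {σ σ' : Sb B Γ Δ} → (∀ {p} (x : p ∈ Γ) → σ x ≡ σ' x) →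
               ∀ {p} (x : p ∈ Γ ++ P) → ext-sub P σ x ≡ ext-sub P σ' x
ext-sub-cong {Γ = Γ} P e x with case++ Γ {P} x
... | inj₁ y = cong weaken (e y)
... | inj₂ y = refl

sub-cong  : ∀ {B C Γ Δ p} .(i : B ⊆ C) {σ σ' : Sb C Γ Δ} → (∀ {q} (x : q ∈ Γ) → σ x ≡ σ' x) →
            (d : Der B Γ p) → sub i σ d ≡ sub i σ' d
subs-cong : ∀ {B C Γ Δ Ps} .(i : B ⊆ C) {σ σ' : Sb C Γ Δ} → (∀ {q} (x : q ∈ Γ) → σ x ≡ σ' x) →
            (ds : Ders B Γ Ps) → subs i σ ds ≡ subs i σ' ds
sub-cong i e (var x) = e x
sub-cong i e (app R m ds) = cong (app R _) (subs-cong i e ds)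
subs-cong i e [] = refl
subs-cong i e (_∷_ {P = P} d ds) = cong₂ _∷_ (sub-cong i (ext-sub-cong P e) d) (subs-cong i e ds)

ren-ren  : ∀ {B Γ Δ Θ p} (ρ' : Ren Δ Θ) (ρ : Ren Γ Δ) (d : Der B Γ p) →
           ren ρ' (ren ρ d) ≡ ren (λ x → ρ' (ρ x)) d
rens-ren : ∀ {B Γ Δ Θ Ps} (ρ' : Ren Δ Θ) (ρ : Ren Γ Δ) (ds : Ders B Γ Ps) →
           rens ρ' (rens ρ ds) ≡ rens (λ x → ρ' (ρ x)) ds
ren-ren ρ' ρ (var x) = refl
ren-ren ρ' ρ (app R m ds) = cong (app R m) (rens-ren ρ' ρ ds)
rens-ren ρ' ρ [] = refl
rens-ren {Γ = Γ} {Δ} ρ' ρ (_∷_ {P = P} d ds) =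
  cong₂ _∷_ (trans (ren-ren _ _ d) (ren-cong lem d)) (rens-ren ρ' ρ ds)
  where
  lem : ∀ {q} (x : q ∈ Γ ++ P) → ext-ren P ρ' (ext-ren P ρ x) ≡ ext-ren P (λ y → ρ' (ρ y)) x
  lem x with case++ Γ {P} x
  ... | inj₁ y rewrite case-inl Δ {P} (ρ y) = refl
  ... | inj₂ y rewrite case-inr Δ {P} y = refl

sub-ren  : ∀ {B C Γ Δ Θ p} .(i : B ⊆ C) (σ : Sb C Δ Θ) (ρ : Ren Γ Δ) (d : Der B Γ p) →
           sub i σ (ren ρ d) ≡ sub i (λ x → σ (ρ x)) d
subs-ren : ∀ {B C Γ Δ Θ Ps} .(i : B ⊆ C) (σ : Sb C Δ Θ) (ρ : Ren Γ Δ) (ds : Ders B Γ Ps) →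
           subs i σ (rens ρ ds) ≡ subs i (λ x → σ (ρ x)) ds
sub-ren i σ ρ (var x) = refl
sub-ren i σ ρ (app R m ds) = cong (app R _) (subs-ren i σ ρ ds)
subs-ren i σ ρ [] = refl
subs-ren {Γ = Γ} {Δ} i σ ρ (_∷_ {P = P} d ds) =
  cong₂ _∷_ (trans (sub-ren i _ _ d) (sub-cong i lem d)) (subs-ren i σ ρ ds)
  where
  lem : ∀ {q} (x : q ∈ Γ ++ P) → ext-sub P σ (ext-ren P ρ x) ≡ ext-sub P (λ y → σ (ρ y)) x
  lem x with case++ Γ {P} x
  ... | inj₁ y rewrite case-inl Δ {P} (ρ y) = refl
  ... | inj₂ y rewrite case-inr Δ {P} y = refl

ren-sub  : ∀ {B C Γ Δ Θ p} .(i : B ⊆ C) (ρ : Ren Δ Θ) (σ : Sb C Γ Δ) (d : Der B Γ p) →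
           ren ρ (sub i σ d) ≡ sub i (λ x → ren ρ (σ x)) d
rens-sub : ∀ {B C Γ Δ Θ Ps} .(i : B ⊆ C) (ρ : Ren Δ Θ) (σ : Sb C Γ Δ) (ds : Ders B Γ Ps) →
           rens ρ (subs i σ ds) ≡ subs i (λ x → ren ρ (σ x)) ds
ren-sub i ρ σ (var x) = refl
ren-sub i ρ σ (app R m ds) = cong (app R _) (rens-sub i ρ σ ds)
rens-sub i ρ σ [] = refl
rens-sub {Γ = Γ} {Δ} {Θ} i ρ σ (_∷_ {P = P} d ds) =
  cong₂ _∷_ (trans (ren-sub i _ _ d) (sub-cong i lem d)) (rens-sub i ρ σ ds)
  where
  lem : ∀ {q} (x : q ∈ Γ ++ P) → ren (ext-ren P ρ) (ext-sub P σ x) ≡ ext-sub P (λ y → ren ρ (σ y)) x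
  lem x with case++ Γ {P} x
  ... | inj₁ y = trans (ren-ren _ _ (σ y))
                   (trans (ren-cong (λ z → cong (ren⊎ P ρ) (case-inl Δ {P} z)) (σ y))
                          (sym (ren-ren _ _ (σ y))))
  ... | inj₂ y rewrite case-inr Δ {P} y = refl

sub-sub  : ∀ {A B C Γ Δ Θ p} .(i : B ⊆ C) .(j : A ⊆ B) (τ : Sb C Δ Θ) (σ : Sb B Γ Δ) (d : Der A Γ p) →
           sub i τ (sub j σ d) ≡ sub (λ R m → i R (j R m)) (λ x → sub i τ (σ x)) d
subs-sub : ∀ {A B C Γ Δ Θ Ps} .(i : B ⊆ C) .(j : A ⊆ B) (τ : Sb C Δ Θ) (σ : Sb B Γ Δ) (ds : Ders A Γ Ps) →
           subs i τ (subs j σ ds) ≡ subs (λ R m → i R (j R m)) (λ x → sub i τ (σ x)) ds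
sub-sub i j τ σ (var x) = refl
sub-sub i j τ σ (app R m ds) = cong (app R _) (subs-sub i j τ σ ds)
subs-sub i j τ σ [] = refl
subs-sub {Γ = Γ} {Δ} {Θ} i j τ σ (_∷_ {P = P} d ds) =
  cong₂ _∷_ (trans (sub-sub i j _ _ d) (sub-cong _ lem d)) (subs-sub i j τ σ ds)
  where
  lem : ∀ {q} (x : q ∈ Γ ++ P) → sub i (ext-sub P τ) (ext-sub P σ x) ≡ ext-sub P (λ y → sub i τ (σ y)) x
  lem x with case++ Γ {P} x
  ... | inj₁ y = trans (sub-ren i _ _ (σ y))
                   (trans (sub-cong i (λ z → cong (sub⊎ P τ) (case-inl Δ {P} z)) (σ y))
                          (sym (ren-sub i _ _ (σ y))))
  ... | inj₂ y rewrite case-inr Δ {P} y = refl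

-- The category 𝒲

record Obj : Set₁ where
  constructor ⟨_,_⟩
  field
    base : Base
    ctx  : List Atom
open Obj public

-- A morphism (B,(X:P)) → (C,(Y:Q)) exists only when C ⊆ B (the inclusion
-- proof is irrelevant), and is a tuple of derivations (X:P) ⊢_B Φᵢ : qᵢ.
record Hom (v w : Obj) : Set where
  constructor hom
  field
    .incl : base w ⊆ base v
    tuple : All (Der (base v) (ctx v)) (ctx w)
open Hom public

idW : ∀ {w} → Hom w w
idW {⟨ B , Γ ⟩} = hom (λ R m → m) (All.tabulate var)

_∘W_ : ∀ {u v w} → Hom v w → Hom u v → Hom u w
hom i σ ∘W hom j τ = hom (λ R m → j R (i R m)) (All.map (sub j (All.lookup τ)) σ)

private
  lookup-map′ : ∀ {A : Set} {P Q : A → Set} {f : ∀ {x} → P x → Q x} {xs} (ps : All P xs) {x} (e : x ∈ xs) →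
                All.lookup (All.map f ps) e ≡ f (All.lookup ps e)
  lookup-map′ (p ∷ ps) (here refl) = refl
  lookup-map′ (p ∷ ps) (there e)   = lookup-map′ ps e

  map-map-cong : ∀ {A : Set} {P Q R : A → Set} {f : ∀ {x} → P x → Q x} {g : ∀ {x} → Q x → R x}
                   {h : ∀ {x} → P x → R x} {xs} → (∀ {x} (p : P x) → g (f p) ≡ h p) →
                 (ps : All P xs) → All.map g (All.map f ps) ≡ All.map h ps
  map-map-cong e []       = refl
  map-map-cong e (p ∷ ps) = cong₂ _∷_ (e p) (map-map-cong e ps)

assocW : ∀ {t u v w} (h : Hom v w) (g : Hom u v) (f : Hom t u) →
         h ∘W (g ∘W f) ≡ (h ∘W g) ∘W f
assocW (hom i σ) (hom j τ) (hom k υ) =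
  sym (cong (hom _) (map-map-cong
    (λ d → trans (sub-sub k j (All.lookup υ) (All.lookup τ) d)
                 (sub-cong _ (λ x → sym (lookup-map′ τ x)) d)) σ))

-- Presheaves on 𝒲 (Set-valued presheaves presented as setoid-valued
-- families; the setoid equality is the equality of the presheaf).

record Psh : Set₂ where
  field
    Ob  : Obj → Set₁
    _≈_ : ∀ {w} → Ob w → Ob w → Set₁
    act : ∀ {v w} → Hom v w → Ob w → Ob v
open Psh public

AtomPsh : Atom → Psh
Ob  (AtomPsh p) w = Lift (lsuc lzero) (Der (base w) (ctx w) p)
_≈_ (AtomPsh p) x y = x ≡ y
act (AtomPsh p) (hom i σ) (lift d) = lift (sub i (All.lookup σ) d)

_×P_ : Psh → Psh → Psh
Ob  (F ×P G) w = Ob F w × Ob G w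
_≈_ (F ×P G) (x , y) (x' , y') = _≈_ F x x' × _≈_ G y y'
act (F ×P G) f (x , y) = act F f x , act G f y

⊤P : Psh
Ob  ⊤P w = ⊤
_≈_ ⊤P _ _ = ⊤
act ⊤P _ _ = tt

ΠP : (Atom → Psh) → Psh
Ob  (ΠP F) w = ∀ p → Ob (F p) w
_≈_ (ΠP F) x y = ∀ p → _≈_ (F p) (x p) (y p)
act (ΠP F) f x p = act (F p) f (x p)

-- (F ⊃ G)(w) = natural transformations 𝒲(-,w) × F → G
record ExpEl (F G : Psh) (w : Obj) : Set₁ where
  field
    fun  : ∀ {v} → Hom v w → Ob F v → Ob G v
    resp : ∀ {v} (g : Hom v w) {x y} → _≈_ F x y → _≈_ G (fun g x) (fun g y)
    nat  : ∀ {u v} (g : Hom v w) (h : Hom u v) (x : Ob F v) →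
           _≈_ G (fun (g ∘W h) (act F h x)) (act G h (fun g x))
open ExpEl public

_⊃P_ : Psh → Psh → Psh
Ob  (F ⊃P G) = ExpEl F G
_≈_ (F ⊃P G) η η' = ∀ {v} (g : Hom v _) (x : Ob F v) → _≈_ G (fun η g x) (fun η' g x)
fun  (act (F ⊃P G) f η) g x = fun η (f ∘W g) x
resp (act (F ⊃P G) f η) g e = resp η (f ∘W g) e
nat  (act (F ⊃P G) f η) g h x =
  subst (λ k → _≈_ G (fun η k (act F h x)) (act G h (fun η (f ∘W g) x)))
        (sym (assocW f g h)) (nat η (f ∘W g) h x)

⟦_⟧ : Formula → Psh
⟦ atom p ⟧ = AtomPsh p
⟦ ⊥′ ⟧     = ΠP AtomPsh
⟦ φ ∧′ ψ ⟧ = ⟦ φ ⟧ ×P ⟦ ψ ⟧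
⟦ φ ∨′ ψ ⟧ = ΠP (λ p → (⟦ φ ⟧ ⊃P AtomPsh p) ⊃P ((⟦ ψ ⟧ ⊃P AtomPsh p) ⊃P AtomPsh p))
⟦ φ ⊃′ ψ ⟧ = ⟦ φ ⟧ ⊃P ⟦ ψ ⟧

⟦_⟧* : List Formula → Psh
⟦ [] ⟧*    = ⊤P
⟦ φ ∷ Γ ⟧* = ⟦ φ ⟧ ×P ⟦ Γ ⟧*

record NatTrans (F G : Psh) : Set₁ where
  field
    η    : ∀ {w} → Ob F w → Ob G w
    resp : ∀ {w} {x y : Ob F w} → _≈_ F x y → _≈_ G (η x) (η y)
    nat  : ∀ {v w} (f : Hom v w) (x : Ob F w) → _≈_ G (η (act F f x)) (act G f (η x))

_⊨_ : List Formula → Formula → Set₁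
Γ ⊨ φ = NatTrans ⟦ Γ ⟧* ⟦ φ ⟧

module Submission where

-- Both relations coincide with derivability in natural deduction. Soundness is by induction on
-- derivations; the presheaf interpretation is cartesian closed, and ⊩ is monotone in the base.
-- Completeness follows Sandqvist: give every subformula χ of Γ, φ an atom flat χ, and let the
-- base N contain, for each connective, its introduction and elimination rules on these atoms. Over bases
-- extending N, validity of χ coincides with derivability of flat χ; likewise natural maps reflect
-- and reify relate ⟦χ⟧ and ⟦flat χ⟧ over worlds whose base extends N. Either way, Γ entailing φ
-- yields an N-derivation of flat φ from flat Γ, and reading its rules back as natural deduction
-- steps gives Γ ⊢ φ.

open import Defs
open import Level using (lift; lower)
open import Data.Empty using (⊥-elim)
open import Data.Unit.Polymorphic using (⊤; tt)
open import Data.Nat as ℕ using (ℕ; suc; _+_; _⊔_; _≤_; s≤s)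
open import Data.Nat.Properties using (m≤m⊔n; m≤n⇒m≤o⊔n; +-cancelˡ-≡; <⇒≱; m≤m+n; suc-injective)
open import Data.Product using (∃; _×_; _,_; proj₁; proj₂)
import Data.Product.Properties as Product
open import Data.Sum using (_⊎_; inj₁; inj₂; [_,_]′)
open import Data.List using (List; []; _∷_; _++_; map; concatMap)
import Data.List.Properties as List
open import Data.List.Relation.Unary.Any using (here; there)
open import Data.List.Relation.Unary.All as All using (All; []; _∷_)
open import Data.List.Relation.Unary.All.Properties using (lookup-map)
open import Data.List.Membership.Propositional using (_∈_; find; lose)
open import Data.List.Membership.Propositional.Properties
  using (∈-++⁺ˡ; ∈-++⁺ʳ; ∈-++⁻; ∈-map⁺; ∈-map⁻; ∈-concatMap⁺; ∈-concatMap⁻)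
import Data.List.Membership.DecPropositional as DecMembership
open import Data.List.Relation.Binary.Subset.Propositional using () renaming (_⊆_ to _⊆ᶜ_)
open import Data.List.Relation.Binary.Subset.Propositional.Properties using (∷⁺ʳ; ++⁺; xs⊆xs++ys)
open import Function.Bundles using (_⇔_; mk⇔)
open import Relation.Nullary using (yes; no)
open import Relation.Nullary.Decidable using (recompute; map′; _×-dec_)
open import Relation.Binary.Definitions using (DecidableEquality)
open import Relation.Binary.PropositionalEquality
  using (_≡_; _≢_; refl; sym; trans; cong; cong₂; subst; module ≡-Reasoning)

-- Natural deduction

-- ∨ and ⊥ are given by their second-order definitions, as in ⊩ and ⟦_⟧.
infix 3 _⊢_

data _⊢_ : List Formula → Formula → Set where
  hyp : ∀ {Δ χ} → χ ∈ Δ → Δ ⊢ χ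
  ∧I  : ∀ {Δ α β} → Δ ⊢ α → Δ ⊢ β → Δ ⊢ α ∧′ β
  ∧E₁ : ∀ {Δ α β} → Δ ⊢ α ∧′ β → Δ ⊢ α
  ∧E₂ : ∀ {Δ α β} → Δ ⊢ α ∧′ β → Δ ⊢ β
  ⊃I  : ∀ {Δ α β} → α ∷ Δ ⊢ β → Δ ⊢ α ⊃′ β
  ⊃E  : ∀ {Δ α β} → Δ ⊢ α ⊃′ β → Δ ⊢ α → Δ ⊢ β
  ⊥I  : ∀ {Δ} → (∀ p → Δ ⊢ atom p) → Δ ⊢ ⊥′
  ⊥E  : ∀ {Δ} p → Δ ⊢ ⊥′ → Δ ⊢ atom p
  ∨I  : ∀ {Δ α β} → (∀ p → Δ ⊢ (α ⊃′ atom p) ⊃′ (β ⊃′ atom p) ⊃′ atom p) → Δ ⊢ α ∨′ β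
  ∨E  : ∀ {Δ α β} p → Δ ⊢ α ∨′ β → Δ ⊢ (α ⊃′ atom p) ⊃′ (β ⊃′ atom p) ⊃′ atom p

⊢-rename : ∀ {Δ Δ' χ} → Δ ⊆ᶜ Δ' → Δ ⊢ χ → Δ' ⊢ χ
⊢-rename ρ (hyp x)  = hyp (ρ x)
⊢-rename ρ (∧I d e) = ∧I (⊢-rename ρ d) (⊢-rename ρ e)
⊢-rename ρ (∧E₁ d)  = ∧E₁ (⊢-rename ρ d)
⊢-rename ρ (∧E₂ d)  = ∧E₂ (⊢-rename ρ d)
⊢-rename ρ (⊃I d)   = ⊃I (⊢-rename (∷⁺ʳ _ ρ) d)
⊢-rename ρ (⊃E d e) = ⊃E (⊢-rename ρ d) (⊢-rename ρ e)
⊢-rename ρ (⊥I d)   = ⊥I (λ p → ⊢-rename ρ (d p))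
⊢-rename ρ (⊥E p d) = ⊥E p (⊢-rename ρ d)
⊢-rename ρ (∨I d)   = ∨I (λ p → ⊢-rename ρ (d p))
⊢-rename ρ (∨E p d) = ∨E p (⊢-rename ρ d)

⊢-weaken : ∀ {Δ α χ} → Δ ⊢ χ → α ∷ Δ ⊢ χ
⊢-weaken = ⊢-rename there

∨I₁ : ∀ {Δ α β} → Δ ⊢ α → Δ ⊢ α ∨′ β
∨I₁ d = ∨I (λ p → ⊃I (⊃I (⊃E (hyp (there (here refl))) (⊢-weaken (⊢-weaken d)))))

∨I₂ : ∀ {Δ α β} → Δ ⊢ β → Δ ⊢ α ∨′ β
∨I₂ d = ∨I (λ p → ⊃I (⊃I (⊃E (hyp (here refl)) (⊢-weaken (⊢-weaken d)))))

∨-elim-atom : ∀ {Δ α β} p → Δ ⊢ α ∨′ β → α ∷ Δ ⊢ atom p → β ∷ Δ ⊢ atom p → Δ ⊢ atom p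
∨-elim-atom p d e₁ e₂ = ⊃E (⊃E (∨E p d) (⊃I e₁)) (⊃I e₂)

∨-elim : ∀ {Δ α β} χ → Δ ⊢ α ∨′ β → α ∷ Δ ⊢ χ → β ∷ Δ ⊢ χ → Δ ⊢ χ
∨-elim (atom p) d e₁ e₂ = ∨-elim-atom p d e₁ e₂
∨-elim ⊥′ d e₁ e₂ = ⊥I (λ p → ∨-elim-atom p d (⊥E p e₁) (⊥E p e₂))
∨-elim (χ ∧′ χ') d e₁ e₂ = ∧I (∨-elim χ d (∧E₁ e₁) (∧E₁ e₂)) (∨-elim χ' d (∧E₂ e₁) (∧E₂ e₂))
∨-elim {Δ} (χ ∨′ χ') d e₁ e₂ =
  ∨I (λ p → ⊃I (⊃I (∨-elim-atom p (⊢-weaken (⊢-weaken d)) (case-to p e₁) (case-to p e₂))))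
  where
  case-to : ∀ {γ} p → γ ∷ Δ ⊢ χ ∨′ χ' → γ ∷ (χ' ⊃′ atom p) ∷ (χ ⊃′ atom p) ∷ Δ ⊢ atom p
  case-to p e = ⊃E (⊃E (∨E p (⊢-rename (∷⁺ʳ _ (λ x → there (there x))) e))
                       (hyp (there (there (here refl)))))
                   (hyp (there (here refl)))
∨-elim {Δ} (χ ⊃′ χ') d e₁ e₂ = ⊃I (∨-elim χ' (⊢-weaken d) (apply-to e₁) (apply-to e₂))
  where
  apply-to : ∀ {γ} → γ ∷ Δ ⊢ χ ⊃′ χ' → γ ∷ χ ∷ Δ ⊢ χ'
  apply-to e = ⊃E (⊢-rename (∷⁺ʳ _ there) e) (hyp (there (here refl)))

⊥-elim′ : ∀ {Δ} χ → Δ ⊢ ⊥′ → Δ ⊢ χ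
⊥-elim′ (atom p)  d = ⊥E p d
⊥-elim′ ⊥′        d = d
⊥-elim′ (χ ∧′ χ') d = ∧I (⊥-elim′ χ d) (⊥-elim′ χ' d)
⊥-elim′ (χ ∨′ χ') d = ∨I₁ (⊥-elim′ χ d)
⊥-elim′ (χ ⊃′ χ') d = ⊃I (⊥-elim′ χ' (⊢-weaken d))

⊆-refl : ∀ {B} → B ⊆ B
⊆-refl R m = m

⊆-trans : ∀ {A B C} → A ⊆ B → B ⊆ C → A ⊆ C
⊆-trans i j R m = j R (i R m)

⊢[]-mono  : ∀ {B C P p} → B ⊆ C → P ⊢[ B ] p → P ⊢[ C ] p
⊢[]-monos : ∀ {B C P Ps} → B ⊆ C → All (λ Pq → (P ++ proj₁ Pq) ⊢[ B ] proj₂ Pq) Ps →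
            All (λ Pq → (P ++ proj₁ Pq) ⊢[ C ] proj₂ Pq) Ps
⊢[]-mono i (Ref x)      = Ref x
⊢[]-mono i (App R m ds) = App R (i R m) (⊢[]-monos i ds)
⊢[]-monos i []       = []
⊢[]-monos i (d ∷ ds) = ⊢[]-mono i d ∷ ⊢[]-monos i ds

⊩-mono : ∀ {B C} φ → B ⊆ C → ⊩[ B ] φ → ⊩[ C ] φ
⊩-mono (atom p) i (lift d) = lift (⊢[]-mono i d)
⊩-mono ⊥′       i v        = λ p → ⊩-mono (atom p) i (v p)
⊩-mono (φ ∧′ ψ) i (a , b)  = ⊩-mono φ i a , ⊩-mono ψ i b
⊩-mono (φ ∨′ ψ) i v        = λ p D j → v p D (⊆-trans i j)
⊩-mono (φ ⊃′ ψ) i v        = λ D j → v D (⊆-trans i j)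

⊢⇒⊩ : ∀ {Δ χ} → Δ ⊢ χ → Δ ⊩ χ
⊢⇒⊩ (hyp x)  B γs = All.lookup γs x
⊢⇒⊩ (∧I d e) B γs = ⊢⇒⊩ d B γs , ⊢⇒⊩ e B γs
⊢⇒⊩ (∧E₁ d)  B γs = proj₁ (⊢⇒⊩ d B γs)
⊢⇒⊩ (∧E₂ d)  B γs = proj₂ (⊢⇒⊩ d B γs)
⊢⇒⊩ (⊃I d)   B γs = λ C i a → ⊢⇒⊩ d C (a ∷ All.map (λ {χ} → ⊩-mono χ i) γs)
⊢⇒⊩ (⊃E d e) B γs = ⊢⇒⊩ d B γs B ⊆-refl (⊢⇒⊩ e B γs)
⊢⇒⊩ (⊥I d)   B γs = λ p → ⊢⇒⊩ (d p) B γs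
⊢⇒⊩ (⊥E p d) B γs = ⊢⇒⊩ d B γs p
⊢⇒⊩ (∨I d)   B γs = λ p C i kα kβ → ⊢⇒⊩ (d p) B γs C i kα C ⊆-refl kβ
⊢⇒⊩ (∨E p d) B γs = λ C i kα D j kβ →
  ⊢⇒⊩ d B γs p D (⊆-trans i j) (λ E k → kα E (⊆-trans j k)) kβ

-- The category 𝒲

case++-inverse : ∀ {A : Set} (Γ : List A) {P} {p : A} (x : p ∈ Γ ++ P) →
                 [ inl , inr Γ ]′ (case++ Γ x) ≡ x
case++-inverse []      x        = refl
case++-inverse (q ∷ Γ) (here e) = refl
case++-inverse (q ∷ Γ) {P} (there x) with case++ Γ {P} x | case++-inverse Γ {P} x
... | inj₁ y | e = cong there e
... | inj₂ y | e = cong there e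

ext-sub-identity : ∀ {B Γ} P {σ : Sb B Γ Γ} → (∀ {q} (x : q ∈ Γ) → σ x ≡ var x) →
                   ∀ {p} (x : p ∈ Γ ++ P) → ext-sub P σ x ≡ var x
ext-sub-identity {Γ = Γ} P e x =
  trans (ext-sub-cong P e x) (trans (sub⊎-var (case++ Γ x)) (cong var (case++-inverse Γ x)))
  where
  sub⊎-var : ∀ {p} (s : p ∈ Γ ⊎ p ∈ P) → sub⊎ P var s ≡ var ([ inl , inr Γ ]′ s)
  sub⊎-var (inj₁ y) = refl
  sub⊎-var (inj₂ y) = refl

sub-identity  : ∀ {B Γ p} .(i : B ⊆ B) {σ : Sb B Γ Γ} → (∀ {q} (x : q ∈ Γ) → σ x ≡ var x) →
                (d : Der B Γ p) → sub i σ d ≡ d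
subs-identity : ∀ {B Γ Ps} .(i : B ⊆ B) {σ : Sb B Γ Γ} → (∀ {q} (x : q ∈ Γ) → σ x ≡ var x) →
                (ds : Ders B Γ Ps) → subs i σ ds ≡ ds
sub-identity i e (var x)      = e x
sub-identity i e (app R m ds) = cong (app R _) (subs-identity i e ds)
subs-identity i e []                 = refl
subs-identity i e (_∷_ {P = P} d ds) =
  cong₂ _∷_ (sub-identity i (ext-sub-identity P e) d) (subs-identity i e ds)

sub-var≡ren  : ∀ {B Γ Δ p} .(i : B ⊆ B) (ρ : Ren Γ Δ) (d : Der B Γ p) →
               sub i (λ x → var (ρ x)) d ≡ ren ρ d
subs-var≡ren : ∀ {B Γ Δ Ps} .(i : B ⊆ B) (ρ : Ren Γ Δ) (ds : Ders B Γ Ps) →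
               subs i (λ x → var (ρ x)) ds ≡ rens ρ ds
sub-var≡ren i ρ (var x)      = refl
sub-var≡ren i ρ (app R m ds) = cong (app R _) (subs-var≡ren i ρ ds)
subs-var≡ren i ρ []                 = refl
subs-var≡ren {Γ = Γ} i ρ (_∷_ {P = P} d ds) =
  cong₂ _∷_ (trans (sub-cong i ext-var d) (sub-var≡ren i (ext-ren P ρ) d)) (subs-var≡ren i ρ ds)
  where
  ext-var : ∀ {q} (x : q ∈ Γ ++ P) → ext-sub P (λ y → var (ρ y)) x ≡ var (ext-ren P ρ x)
  ext-var x with case++ Γ {P} x
  ... | inj₁ y = refl
  ... | inj₂ y = refl

ext-sub-sub : ∀ {B C Γ Δ Θ} P .(j : B ⊆ C) (τ : Sb C Δ Θ) (σ : Sb B Γ Δ) {p} (x : p ∈ Γ ++ P) →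
              ext-sub P (λ y → sub j τ (σ y)) x ≡ sub j (ext-sub P τ) (ext-sub P σ x)
ext-sub-sub {Γ = Γ} {Δ} P j τ σ x with case++ Γ {P} x
... | inj₁ y = trans (ren-sub j inl τ (σ y))
                 (trans (sub-cong j (λ z → sym (cong (sub⊎ P τ) (case-inl Δ {P} z))) (σ y))
                        (sym (sub-ren j (ext-sub P τ) inl (σ y))))
... | inj₂ y = sym (cong (sub⊎ P τ) (case-inr Δ {P} y))

lookup-tabulate : ∀ {A : Set} {P : A → Set} {xs : List A} (f : ∀ {x} → x ∈ xs → P x)
                  {x} (e : x ∈ xs) →
                  All.lookup (All.tabulate f) e ≡ f e
lookup-tabulate {xs = x ∷ xs} f (here refl) = refl
lookup-tabulate {xs = x ∷ xs} f (there e)   = lookup-tabulate (λ z → f (there z)) e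

All-ext : ∀ {A : Set} {P : A → Set} {xs} (a b : All P xs) →
          (∀ {x} (e : x ∈ xs) → All.lookup a e ≡ All.lookup b e) → a ≡ b
All-ext []      []      h = refl
All-ext (x ∷ a) (y ∷ b) h = cong₂ _∷_ (h (here refl)) (All-ext a b (λ e → h (there e)))

⟪_⟫ : ∀ {v w} → Hom v w → Sb (base v) (ctx w) (ctx v)
⟪ f ⟫ = All.lookup (tuple f)

subHom : ∀ {v w p} → Hom v w → Der (base w) (ctx w) p → Der (base v) (ctx v) p
subHom (hom i σ) = sub i (All.lookup σ)

Hom-ext : ∀ {v w} (f g : Hom v w) → (∀ {p} (x : p ∈ ctx w) → ⟪ f ⟫ x ≡ ⟪ g ⟫ x) → f ≡ g
Hom-ext f g h = cong (hom _) (All-ext (tuple f) (tuple g) h)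

⟪∘W⟫ : ∀ {u v w} (g : Hom v w) (h : Hom u v) {p} (x : p ∈ ctx w) → ⟪ g ∘W h ⟫ x ≡ subHom h (⟪ g ⟫ x)
⟪∘W⟫ g h x = lookup-map (tuple g) x

⟪idW⟫ : ∀ {w p} (x : p ∈ ctx w) → ⟪ idW {w} ⟫ x ≡ var x
⟪idW⟫ x = lookup-tabulate var x

subHom-idW : ∀ {w p} (d : Der (base w) (ctx w) p) → subHom idW d ≡ d
subHom-idW d = sub-identity _ ⟪idW⟫ d

subHom-∘W : ∀ {u v w p} (g : Hom v w) (h : Hom u v) (d : Der (base w) (ctx w) p) →
            subHom (g ∘W h) d ≡ subHom h (subHom g d)
subHom-∘W g@(hom i σ) h@(hom j τ) d =
  trans (sub-cong _ (⟪∘W⟫ g h) d) (sym (sub-sub j i (All.lookup τ) (All.lookup σ) d))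

∘W-identityˡ : ∀ {u w} (f : Hom u w) → idW ∘W f ≡ f
∘W-identityˡ f = Hom-ext _ _ (λ x → trans (⟪∘W⟫ idW f x) (cong (subHom f) (⟪idW⟫ x)))

∘W-identityʳ : ∀ {u w} (f : Hom u w) → f ∘W idW ≡ f
∘W-identityʳ f = Hom-ext _ _ (λ x → trans (⟪∘W⟫ f idW x) (subHom-idW (⟪ f ⟫ x)))

_⁺_ : Obj → List Atom → Obj
w ⁺ P = ⟨ base w , ctx w ++ P ⟩

extW : ∀ {v w} P → Hom v w → Hom (v ⁺ P) (w ⁺ P)
extW P f@(hom i σ) = hom i (All.tabulate (ext-sub P ⟪ f ⟫))

wkW : ∀ {w} P → Hom (w ⁺ P) w
wkW P = hom (λ R m → m) (All.tabulate (λ x → var (inl x)))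

⟪extW⟫ : ∀ {v w} P (f : Hom v w) {p} (x : p ∈ ctx w ++ P) → ⟪ extW P f ⟫ x ≡ ext-sub P ⟪ f ⟫ x
⟪extW⟫ P f x = lookup-tabulate _ x

subHom-extW : ∀ {v w} P .(i : base w ⊆ base v) (σ : All (Der (base v) (ctx v)) (ctx w)) {p}
              (d : Der (base w) (ctx w ++ P) p) →
              subHom (extW P (hom i σ)) d ≡ sub i (ext-sub P (All.lookup σ)) d
subHom-extW P i σ d = sub-cong _ (⟪extW⟫ P (hom i σ)) d

extW-idW : ∀ {w} P → extW P (idW {w}) ≡ idW
extW-idW P = Hom-ext _ _ (λ x →
  trans (⟪extW⟫ P idW x) (trans (ext-sub-identity P ⟪idW⟫ x) (sym (⟪idW⟫ x))))

extW-∘W : ∀ {u v w} P (g : Hom v w) (h : Hom u v) → extW P (g ∘W h) ≡ extW P g ∘W extW P h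
extW-∘W P g h@(hom j τ) = Hom-ext _ _ λ x → begin
  ⟪ extW P (g ∘W h) ⟫ x                               ≡⟨ ⟪extW⟫ P (g ∘W h) x ⟩
  ext-sub P ⟪ g ∘W h ⟫ x                              ≡⟨ ext-sub-cong P (⟪∘W⟫ g h) x ⟩
  ext-sub P (λ y → subHom h (⟪ g ⟫ y)) x              ≡⟨ ext-sub-sub P j ⟪ h ⟫ ⟪ g ⟫ x ⟩
  sub j (ext-sub P ⟪ h ⟫) (ext-sub P ⟪ g ⟫ x)         ≡⟨ sym (subHom-extW P j τ (ext-sub P ⟪ g ⟫ x)) ⟩
  subHom (extW P h) (ext-sub P ⟪ g ⟫ x)               ≡⟨ cong (subHom (extW P h)) (sym (⟪extW⟫ P g x)) ⟩
  subHom (extW P h) (⟪ extW P g ⟫ x)                  ≡⟨ sym (⟪∘W⟫ (extW P g) (extW P h) x) ⟩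
  ⟪ extW P g ∘W extW P h ⟫ x                          ∎
  where open ≡-Reasoning

wkW-natural : ∀ {v w} P (f : Hom v w) → f ∘W wkW P ≡ wkW P ∘W extW P f
wkW-natural {w = w} P f = Hom-ext _ _ λ x → begin
  ⟪ f ∘W wkW P ⟫ x                           ≡⟨ ⟪∘W⟫ f (wkW P) x ⟩
  subHom (wkW P) (⟪ f ⟫ x)                   ≡⟨ sub-cong _ (lookup-tabulate _) (⟪ f ⟫ x) ⟩
  sub _ (λ y → var (inl y)) (⟪ f ⟫ x)        ≡⟨ sub-var≡ren _ inl (⟪ f ⟫ x) ⟩
  ren inl (⟪ f ⟫ x)                          ≡⟨ cong (sub⊎ P ⟪ f ⟫) (case-inl (ctx w) {P} x) ⟨
  ext-sub P ⟪ f ⟫ (inl x)                    ≡⟨ ⟪extW⟫ P f (inl x) ⟨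
  ⟪ extW P f ⟫ (inl x)                       ≡⟨ cong (subHom (extW P f)) (lookup-tabulate _ x) ⟨
  subHom (extW P f) (⟪ wkW P ⟫ x)            ≡⟨ ⟪∘W⟫ (wkW P) (extW P f) x ⟨
  ⟪ wkW P ∘W extW P f ⟫ x                    ∎
  where open ≡-Reasoning

fresh∈ : ∀ w a → a ∈ ctx (w ⁺ (a ∷ []))
fresh∈ w a = inr (ctx w) (here refl)

⟪extW⟫-fresh : ∀ {v w} a (f : Hom v w) → ⟪ extW (a ∷ []) f ⟫ (fresh∈ w a) ≡ var (fresh∈ v a)
⟪extW⟫-fresh {w = w} a f =
  trans (⟪extW⟫ (a ∷ []) f (fresh∈ w a)) (cong (sub⊎ (a ∷ []) ⟪ f ⟫) (case-inr (ctx w) (here refl)))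

-- Presheaves

record IsPresheaf (F : Psh) : Set₁ where
  field
    ≈-refl   : ∀ {w} {x : Ob F w} → _≈_ F x x
    ≈-sym    : ∀ {w} {x y : Ob F w} → _≈_ F x y → _≈_ F y x
    ≈-trans  : ∀ {w} {x y z : Ob F w} → _≈_ F x y → _≈_ F y z → _≈_ F x z
    act-cong : ∀ {v w} (f : Hom v w) {x y : Ob F w} → _≈_ F x y → _≈_ F (act F f x) (act F f y)
    act-idW  : ∀ {w} (x : Ob F w) → _≈_ F (act F idW x) x
    act-∘W   : ∀ {u v w} (g : Hom v w) (h : Hom u v) (x : Ob F w) →
               _≈_ F (act F (g ∘W h) x) (act F h (act F g x))

  ≡⇒≈ : ∀ {w} {x y : Ob F w} → x ≡ y → _≈_ F x y
  ≡⇒≈ refl = ≈-refl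
open IsPresheaf

atom-isPresheaf : ∀ p → IsPresheaf (AtomPsh p)
≈-refl   (atom-isPresheaf p) = refl
≈-sym    (atom-isPresheaf p) = sym
≈-trans  (atom-isPresheaf p) = trans
act-cong (atom-isPresheaf p) f refl = refl
act-idW  (atom-isPresheaf p) (lift d) = cong lift (subHom-idW d)
act-∘W   (atom-isPresheaf p) g h (lift d) = cong lift (subHom-∘W g h d)

×-isPresheaf : ∀ {F G} → IsPresheaf F → IsPresheaf G → IsPresheaf (F ×P G)
≈-refl   (×-isPresheaf F G) = ≈-refl F , ≈-refl G
≈-sym    (×-isPresheaf F G) (a , b) = ≈-sym F a , ≈-sym G b
≈-trans  (×-isPresheaf F G) (a , b) (c , d) = ≈-trans F a c , ≈-trans G b d
act-cong (×-isPresheaf F G) f (a , b) = act-cong F f a , act-cong G f b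
act-idW  (×-isPresheaf F G) (x , y) = act-idW F x , act-idW G y
act-∘W   (×-isPresheaf F G) g h (x , y) = act-∘W F g h x , act-∘W G g h y

⊤-isPresheaf : IsPresheaf ⊤P
≈-refl   ⊤-isPresheaf = tt
≈-sym    ⊤-isPresheaf _ = tt
≈-trans  ⊤-isPresheaf _ _ = tt
act-cong ⊤-isPresheaf _ _ = tt
act-idW  ⊤-isPresheaf _ = tt
act-∘W   ⊤-isPresheaf _ _ _ = tt

Π-isPresheaf : ∀ {F : Atom → Psh} → (∀ p → IsPresheaf (F p)) → IsPresheaf (ΠP F)
≈-refl   (Π-isPresheaf F) p = ≈-refl (F p)
≈-sym    (Π-isPresheaf F) e p = ≈-sym (F p) (e p)
≈-trans  (Π-isPresheaf F) e e' p = ≈-trans (F p) (e p) (e' p)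
act-cong (Π-isPresheaf F) f e p = act-cong (F p) f (e p)
act-idW  (Π-isPresheaf F) x p = act-idW (F p) (x p)
act-∘W   (Π-isPresheaf F) g h x p = act-∘W (F p) g h (x p)

⊃-isPresheaf : ∀ {F G} → IsPresheaf G → IsPresheaf (F ⊃P G)
≈-refl   (⊃-isPresheaf G) g x = ≈-refl G
≈-sym    (⊃-isPresheaf G) e g x = ≈-sym G (e g x)
≈-trans  (⊃-isPresheaf G) e e' g x = ≈-trans G (e g x) (e' g x)
act-cong (⊃-isPresheaf G) f e g x = e (f ∘W g) x
act-idW  (⊃-isPresheaf G) η g x = ≡⇒≈ G (cong (λ k → fun η k x) (∘W-identityˡ g))
act-∘W   (⊃-isPresheaf G) f h η g x = ≡⇒≈ G (cong (λ k → fun η k x) (sym (assocW f h g)))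

record Presheaf : Set₂ where
  constructor presheaf
  field
    psh        : Psh
    isPresheaf : IsPresheaf psh
open Presheaf

∣_∣ : Presheaf → Obj → Set₁
∣ F ∣ = Ob (psh F)

infix 2 _⟶_

record _⟶_ (F G : Presheaf) : Set₁ where
  field
    apply      : ∀ {w} → ∣ F ∣ w → ∣ G ∣ w
    apply-cong : ∀ {w} {x y : ∣ F ∣ w} → _≈_ (psh F) x y → _≈_ (psh G) (apply x) (apply y)
    natural    : ∀ {v w} (f : Hom v w) (x : ∣ F ∣ w) →
                 _≈_ (psh G) (apply (act (psh F) f x)) (act (psh G) f (apply x))
open _⟶_

toNatTrans : ∀ {F G} → F ⟶ G → NatTrans (psh F) (psh G)
toNatTrans α = record { η = apply α ; resp = apply-cong α ; nat = natural α }

Atomᴾ : Atom → Presheaf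
Atomᴾ p = presheaf (AtomPsh p) (atom-isPresheaf p)

⊤ᴾ : Presheaf
⊤ᴾ = presheaf ⊤P ⊤-isPresheaf

infixr 6 _×ᴾ_
infixr 4 _⊃ᴾ_

_×ᴾ_ : Presheaf → Presheaf → Presheaf
F ×ᴾ G = presheaf (psh F ×P psh G) (×-isPresheaf (isPresheaf F) (isPresheaf G))

Πᴾ : (Atom → Presheaf) → Presheaf
Πᴾ F = presheaf (ΠP (λ p → psh (F p))) (Π-isPresheaf (λ p → isPresheaf (F p)))

_⊃ᴾ_ : Presheaf → Presheaf → Presheaf
F ⊃ᴾ G = presheaf (psh F ⊃P psh G) (⊃-isPresheaf (isPresheaf G))

infixr 9 _∘_

_∘_ : ∀ {F G H} → G ⟶ H → F ⟶ G → F ⟶ H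
apply      (β ∘ α) x = apply β (apply α x)
apply-cong (β ∘ α) e = apply-cong β (apply-cong α e)
natural    (_∘_ {H = H} β α) f x =
  ≈-trans (isPresheaf H) (apply-cong β (natural α f x)) (natural β f (apply α x))

<_,_> : ∀ {F G H} → F ⟶ G → F ⟶ H → F ⟶ G ×ᴾ H
apply      < α , β > x = apply α x , apply β x
apply-cong < α , β > e = apply-cong α e , apply-cong β e
natural    < α , β > f x = natural α f x , natural β f x

π₁ : ∀ {F G} → F ×ᴾ G ⟶ F
apply      π₁ = proj₁
apply-cong π₁ = proj₁
natural    (π₁ {F}) f x = ≈-refl (isPresheaf F)

π₂ : ∀ {F G} → F ×ᴾ G ⟶ G
apply      π₂ = proj₂
apply-cong π₂ = proj₂
natural    (π₂ {G = G}) f x = ≈-refl (isPresheaf G)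

! : ∀ {F} → F ⟶ ⊤ᴾ
apply      ! _ = tt
apply-cong ! _ = tt
natural    ! _ _ = tt

tabulateΠ : ∀ {F G} → (∀ p → F ⟶ G p) → F ⟶ Πᴾ G
apply      (tabulateΠ α) x p = apply (α p) x
apply-cong (tabulateΠ α) e p = apply-cong (α p) e
natural    (tabulateΠ α) f x p = natural (α p) f x

projΠ : ∀ {G} p → Πᴾ G ⟶ G p
apply      (projΠ p) x = x p
apply-cong (projΠ p) e = e p
natural    (projΠ {G} p) f x = ≈-refl (isPresheaf (G p))

curry : ∀ {F G H} → F ×ᴾ G ⟶ H → F ⟶ G ⊃ᴾ H
apply (curry {F} {G} {H} α) x = record
  { fun  = λ g y → apply α (act (psh F) g x , y)
  ; resp = λ g e → apply-cong α (≈-refl (isPresheaf F) , e)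
  ; nat  = λ g h y → ≈-trans (isPresheaf H)
                       (apply-cong α (act-∘W (isPresheaf F) g h x , ≈-refl (isPresheaf G)))
                       (natural α h (act (psh F) g x , y)) }
apply-cong (curry {F} {G} α) e g y =
  apply-cong α (act-cong (isPresheaf F) g e , ≈-refl (isPresheaf G))
natural    (curry {F} {G} α) f x g y =
  apply-cong α (≈-sym (isPresheaf F) (act-∘W (isPresheaf F) f g x) , ≈-refl (isPresheaf G))

eval : ∀ {G H} → (G ⊃ᴾ H) ×ᴾ G ⟶ H
apply      eval (η , y) = fun η idW y
apply-cong (eval {H = H}) {x = η , _} {y = _ , y'} (e₁ , e₂) =
  ≈-trans (isPresheaf H) (resp η idW e₂) (e₁ idW y')
natural    (eval {G} {H}) f (η , y) =
  ≈-trans (isPresheaf H)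
    (≡⇒≈ (isPresheaf H) (cong (λ k → fun η k (act (psh G) f y))
                             (trans (∘W-identityʳ f) (sym (∘W-identityˡ f)))))
    (nat η idW f y)

infixl 5 _·_

_·_ : ∀ {F G H} → F ⟶ G ⊃ᴾ H → F ⟶ G → F ⟶ H
α · β = eval ∘ < α , β >

infixr 9 _⊚_

_⊚_ : ∀ {E F G H} → E ×ᴾ G ⟶ H → E ×ᴾ F ⟶ G → E ×ᴾ F ⟶ H
β ⊚ α = β ∘ < π₁ , α >

Λ : ∀ {E F G H} → E ×ᴾ (F ×ᴾ G) ⟶ H → E ×ᴾ F ⟶ G ⊃ᴾ H
Λ α = curry (α ∘ < π₁ ∘ π₁ , < π₂ ∘ π₁ , π₂ > >)

infixl 7 _⁺ᴾ_

_⁺ᴾ_ : Presheaf → List Atom → Presheaf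
psh (F ⁺ᴾ P) = record
  { Ob  = λ w → ∣ F ∣ (w ⁺ P)
  ; _≈_ = _≈_ (psh F)
  ; act = λ f → act (psh F) (extW P f) }
≈-refl   (isPresheaf (F ⁺ᴾ P)) = ≈-refl (isPresheaf F)
≈-sym    (isPresheaf (F ⁺ᴾ P)) = ≈-sym (isPresheaf F)
≈-trans  (isPresheaf (F ⁺ᴾ P)) = ≈-trans (isPresheaf F)
act-cong (isPresheaf (F ⁺ᴾ P)) f = act-cong (isPresheaf F) (extW P f)
act-idW  (isPresheaf (F ⁺ᴾ P)) x =
  ≈-trans (isPresheaf F) (≡⇒≈ (isPresheaf F) (cong (λ k → act (psh F) k x) (extW-idW P)))
                         (act-idW (isPresheaf F) x)
act-∘W   (isPresheaf (F ⁺ᴾ P)) g h x =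
  ≈-trans (isPresheaf F) (≡⇒≈ (isPresheaf F) (cong (λ k → act (psh F) k x) (extW-∘W P g h)))
                         (act-∘W (isPresheaf F) (extW P g) (extW P h) x)

weakenᴺ : ∀ {F P} → F ⟶ F ⁺ᴾ P
apply      (weakenᴺ {F} {P}) = act (psh F) (wkW P)
apply-cong (weakenᴺ {F} {P}) = act-cong (isPresheaf F) (wkW P)
natural    (weakenᴺ {F} {P}) f x =
  ≈-trans F̂ (≈-sym F̂ (act-∘W F̂ f (wkW P) x))
    (≈-trans F̂ (≡⇒≈ F̂ (cong (λ k → act (psh F) k x) (wkW-natural P f)))
               (act-∘W F̂ (wkW P) (extW P f) x))
  where
  F̂ : IsPresheaf (psh F)
  F̂ = isPresheaf F

⟦⟧-isPresheaf : ∀ χ → IsPresheaf ⟦ χ ⟧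
⟦⟧-isPresheaf (atom p) = atom-isPresheaf p
⟦⟧-isPresheaf ⊥′       = Π-isPresheaf atom-isPresheaf
⟦⟧-isPresheaf (α ∧′ β) = ×-isPresheaf (⟦⟧-isPresheaf α) (⟦⟧-isPresheaf β)
⟦⟧-isPresheaf (α ∨′ β) = Π-isPresheaf (λ p → ⊃-isPresheaf (⊃-isPresheaf (atom-isPresheaf p)))
⟦⟧-isPresheaf (α ⊃′ β) = ⊃-isPresheaf (⟦⟧-isPresheaf β)

⟦_⟧ᴾ : Formula → Presheaf
⟦ χ ⟧ᴾ = presheaf ⟦ χ ⟧ (⟦⟧-isPresheaf χ)

∨-eliminatorᴾ : Formula → Formula → Atom → Presheaf
∨-eliminatorᴾ a b p = (⟦ a ⟧ᴾ ⊃ᴾ Atomᴾ p) ⊃ᴾ (⟦ b ⟧ᴾ ⊃ᴾ Atomᴾ p) ⊃ᴾ Atomᴾ p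

⟦⟧*-isPresheaf : ∀ Δ → IsPresheaf ⟦ Δ ⟧*
⟦⟧*-isPresheaf []      = ⊤-isPresheaf
⟦⟧*-isPresheaf (χ ∷ Δ) = ×-isPresheaf (⟦⟧-isPresheaf χ) (⟦⟧*-isPresheaf Δ)

⟦_⟧*ᴾ : List Formula → Presheaf
⟦ Δ ⟧*ᴾ = presheaf ⟦ Δ ⟧* (⟦⟧*-isPresheaf Δ)

⟦⟧*-fromAll : ∀ {Δ w} → All (λ χ → ∣ ⟦ χ ⟧ᴾ ∣ w) Δ → ∣ ⟦ Δ ⟧*ᴾ ∣ w
⟦⟧*-fromAll []       = tt
⟦⟧*-fromAll (x ∷ xs) = x , ⟦⟧*-fromAll xs

lookupᴺ : ∀ {Δ χ} → χ ∈ Δ → ⟦ Δ ⟧*ᴾ ⟶ ⟦ χ ⟧ᴾ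
lookupᴺ (here refl) = π₁
lookupᴺ (there x)   = lookupᴺ x ∘ π₂

⊢⇒⊨ : ∀ {Δ χ} → Δ ⊢ χ → ⟦ Δ ⟧*ᴾ ⟶ ⟦ χ ⟧ᴾ
⊢⇒⊨ (hyp x)  = lookupᴺ x
⊢⇒⊨ (∧I d e) = < ⊢⇒⊨ d , ⊢⇒⊨ e >
⊢⇒⊨ (∧E₁ d)  = π₁ ∘ ⊢⇒⊨ d
⊢⇒⊨ (∧E₂ d)  = π₂ ∘ ⊢⇒⊨ d
⊢⇒⊨ (⊃I d)   = curry (⊢⇒⊨ d ∘ < π₂ , π₁ >)
⊢⇒⊨ (⊃E d e) = ⊢⇒⊨ d · ⊢⇒⊨ e
⊢⇒⊨ (⊥I d)   = tabulateΠ (λ p → ⊢⇒⊨ (d p))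
⊢⇒⊨ (⊥E p d) = projΠ p ∘ ⊢⇒⊨ d
⊢⇒⊨ (∨I d)   = tabulateΠ (λ p → ⊢⇒⊨ (d p))
⊢⇒⊨ (∨E p d) = projΠ p ∘ ⊢⇒⊨ d


-- Subformulas

subformulas : Formula → List Formula
subformulas (atom q)   = atom q ∷ []
subformulas ⊥′         = ⊥′ ∷ []
subformulas (a ∧′ b)   = (a ∧′ b) ∷ subformulas a ++ subformulas b
subformulas (a ∨′ b)   = (a ∨′ b) ∷ subformulas a ++ subformulas b
subformulas (a ⊃′ b)   = (a ⊃′ b) ∷ subformulas a ++ subformulas b

infix 3 _≺_

data _≺_ : Formula → Formula → Set where
  ∧ˡ : ∀ {a b} → a ≺ a ∧′ b
  ∧ʳ : ∀ {a b} → b ≺ a ∧′ b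
  ∨ˡ : ∀ {a b} → a ≺ a ∨′ b
  ∨ʳ : ∀ {a b} → b ≺ a ∨′ b
  ⊃ˡ : ∀ {a b} → a ≺ a ⊃′ b
  ⊃ʳ : ∀ {a b} → b ≺ a ⊃′ b

∈-subformulas : ∀ χ → χ ∈ subformulas χ
∈-subformulas (atom q) = here refl
∈-subformulas ⊥′       = here refl
∈-subformulas (a ∧′ b) = here refl
∈-subformulas (a ∨′ b) = here refl
∈-subformulas (a ⊃′ b) = here refl

≺⇒∈-subformulas : ∀ {a c} → a ≺ c → a ∈ subformulas c
≺⇒∈-subformulas {a} ∧ˡ = there (∈-++⁺ˡ (∈-subformulas a))
≺⇒∈-subformulas {b} (∧ʳ {a}) = there (∈-++⁺ʳ (subformulas a) (∈-subformulas b))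
≺⇒∈-subformulas {a} ∨ˡ = there (∈-++⁺ˡ (∈-subformulas a))
≺⇒∈-subformulas {b} (∨ʳ {a}) = there (∈-++⁺ʳ (subformulas a) (∈-subformulas b))
≺⇒∈-subformulas {a} ⊃ˡ = there (∈-++⁺ˡ (∈-subformulas a))
≺⇒∈-subformulas {b} (⊃ʳ {a}) = there (∈-++⁺ʳ (subformulas a) (∈-subformulas b))

subformulas-trans    : ∀ ψ {χ θ} → χ ∈ subformulas ψ → θ ∈ subformulas χ → θ ∈ subformulas ψ
subformulas-++-trans : ∀ a b {χ θ} → χ ∈ subformulas a ++ subformulas b → θ ∈ subformulas χ →
                       θ ∈ subformulas a ++ subformulas b
subformulas-trans (atom q) (here refl) θ∈ = θ∈
subformulas-trans ⊥′       (here refl) θ∈ = θ∈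
subformulas-trans (a ∧′ b) (here refl) θ∈ = θ∈
subformulas-trans (a ∧′ b) (there χ∈)  θ∈ = there (subformulas-++-trans a b χ∈ θ∈)
subformulas-trans (a ∨′ b) (here refl) θ∈ = θ∈
subformulas-trans (a ∨′ b) (there χ∈)  θ∈ = there (subformulas-++-trans a b χ∈ θ∈)
subformulas-trans (a ⊃′ b) (here refl) θ∈ = θ∈
subformulas-trans (a ⊃′ b) (there χ∈)  θ∈ = there (subformulas-++-trans a b χ∈ θ∈)

subformulas-++-trans a b χ∈ θ∈ with ∈-++⁻ (subformulas a) χ∈
... | inj₁ χ∈a = ∈-++⁺ˡ (subformulas-trans a χ∈a θ∈)
... | inj₂ χ∈b = ∈-++⁺ʳ (subformulas a) (subformulas-trans b χ∈b θ∈)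

_≟ᶠ_ : DecidableEquality Formula
atom p   ≟ᶠ atom q   = map′ (cong atom) (λ { refl → refl }) (p ℕ.≟ q)
⊥′       ≟ᶠ ⊥′       = yes refl
(a ∧′ b) ≟ᶠ (c ∧′ d) =
  map′ (λ (e , e') → cong₂ _∧′_ e e') (λ { refl → refl , refl }) (a ≟ᶠ c ×-dec b ≟ᶠ d)
(a ∨′ b) ≟ᶠ (c ∨′ d) =
  map′ (λ (e , e') → cong₂ _∨′_ e e') (λ { refl → refl , refl }) (a ≟ᶠ c ×-dec b ≟ᶠ d)
(a ⊃′ b) ≟ᶠ (c ⊃′ d) =
  map′ (λ (e , e') → cong₂ _⊃′_ e e') (λ { refl → refl , refl }) (a ≟ᶠ c ×-dec b ≟ᶠ d)
atom _   ≟ᶠ ⊥′       = no λ ()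
atom _   ≟ᶠ (_ ∧′ _) = no λ ()
atom _   ≟ᶠ (_ ∨′ _) = no λ ()
atom _   ≟ᶠ (_ ⊃′ _) = no λ ()
⊥′       ≟ᶠ atom _   = no λ ()
⊥′       ≟ᶠ (_ ∧′ _) = no λ ()
⊥′       ≟ᶠ (_ ∨′ _) = no λ ()
⊥′       ≟ᶠ (_ ⊃′ _) = no λ ()
(_ ∧′ _) ≟ᶠ atom _   = no λ ()
(_ ∧′ _) ≟ᶠ ⊥′       = no λ ()
(_ ∧′ _) ≟ᶠ (_ ∨′ _) = no λ ()
(_ ∧′ _) ≟ᶠ (_ ⊃′ _) = no λ ()
(_ ∨′ _) ≟ᶠ atom _   = no λ ()
(_ ∨′ _) ≟ᶠ ⊥′       = no λ ()
(_ ∨′ _) ≟ᶠ (_ ∧′ _) = no λ ()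
(_ ∨′ _) ≟ᶠ (_ ⊃′ _) = no λ ()
(_ ⊃′ _) ≟ᶠ atom _   = no λ ()
(_ ⊃′ _) ≟ᶠ ⊥′       = no λ ()
(_ ⊃′ _) ≟ᶠ (_ ∧′ _) = no λ ()
(_ ⊃′ _) ≟ᶠ (_ ∨′ _) = no λ ()

_≟ᴿ_ : DecidableEquality Rule
(ps ⇒ c) ≟ᴿ (ps' ⇒ c') =
  map′ (λ (e , e') → cong₂ _⇒_ e e') (λ { refl → refl , refl })
       (List.≡-dec (Product.≡-dec (List.≡-dec ℕ._≟_) ℕ._≟_) ps ps' ×-dec c ℕ.≟ c')

position : Formula → List Formula → ℕ
position χ []      = 0
position χ (θ ∷ L) with χ ≟ᶠ θ
... | yes _ = 0
... | no _  = suc (position χ L)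

position-injective : ∀ {χ χ' L} → χ ∈ L → χ' ∈ L → position χ L ≡ position χ' L → χ ≡ χ'
position-injective {χ} {χ'} {θ ∷ L} χ∈ χ'∈ e with χ ≟ᶠ θ | χ' ≟ᶠ θ
... | yes χ≡θ | yes χ'≡θ = trans χ≡θ (sym χ'≡θ)
position-injective (here χ≡θ) _ e | no χ≢θ | _ = ⊥-elim (χ≢θ χ≡θ)
position-injective _ (here χ'≡θ) e | _ | no χ'≢θ = ⊥-elim (χ'≢θ χ'≡θ)
position-injective (there χ∈) (there χ'∈) e | no _ | no _ =
  position-injective χ∈ χ'∈ (suc-injective e)

atomValue : Formula → ℕ
atomValue (atom q) = q
atomValue _        = 0

atomBound : List Formula → ℕ
atomBound []      = 0
atomBound (χ ∷ L) = atomValue χ ⊔ atomBound L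

atomBound-≥ : ∀ {L q} → atom q ∈ L → q ≤ atomBound L
atomBound-≥ {atom q ∷ L} (here refl) = m≤m⊔n q (atomBound L)
atomBound-≥ {χ ∷ L}      (there x)   = m≤n⇒m≤o⊔n (atomValue χ) (atomBound-≥ x)

Axioms : List Atom → Base
Axioms Q R = premises R ≡ [] × conclusion R ∈ Q

infixl 21 _⊕_

_⊕_ : Base → List Atom → Base
(B ⊕ Q) R = B R ⊎ Axioms Q R

⊆-⊕ : ∀ {B Q} → B ⊆ B ⊕ Q
⊆-⊕ R = inj₁

axiom : ∀ {B Q P q} → q ∈ Q → P ⊢[ B ⊕ Q ] q
axiom x = App ([] ⇒ _) (inj₂ (refl , x)) []

discharge  : ∀ {B Q P P' p} → P ⊆ᶜ P' → Q ⊆ᶜ P' → P ⊢[ B ⊕ Q ] p → P' ⊢[ B ] p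
discharges : ∀ {B Q P P' Ps} → P ⊆ᶜ P' → Q ⊆ᶜ P' →
             All (λ Pq → (P ++ proj₁ Pq) ⊢[ B ⊕ Q ] proj₂ Pq) Ps →
             All (λ Pq → (P' ++ proj₁ Pq) ⊢[ B ] proj₂ Pq) Ps
discharge ρ κ (Ref x)                   = Ref (ρ x)
discharge ρ κ (App R (inj₁ r) ds)       = App R r (discharges ρ κ ds)
discharge ρ κ (App R (inj₂ (_ , x)) ds) = Ref (κ x)
discharges ρ κ [] = []
discharges {P' = P'} ρ κ (_∷_ {x = Q , _} d ds) =
  discharge (++⁺ ρ (λ x → x)) (λ x → xs⊆xs++ys P' Q (κ x)) d ∷ discharges ρ κ ds

unary : Atom → Atom → Rule
unary a c = (([] , a) ∷ []) ⇒ c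

binary : Atom → Atom → Atom → Rule
binary a b c = (([] , a) ∷ ([] , b) ∷ []) ⇒ c

module Over (N : Base) where

  record Above (B : Base) : Set₁ where
    constructor above
    field
      .N⊆B : N ⊆ B

  Aboveᴾ : Presheaf
  psh Aboveᴾ = record
    { Ob  = λ w → Above (base w)
    ; _≈_ = λ _ _ → ⊤
    ; act = λ { (hom i σ) (above n) → above (⊆-trans n i) } }
  ≈-refl   (isPresheaf Aboveᴾ) = tt
  ≈-sym    (isPresheaf Aboveᴾ) _ = tt
  ≈-trans  (isPresheaf Aboveᴾ) _ _ = tt
  act-cong (isPresheaf Aboveᴾ) _ _ = tt
  act-idW  (isPresheaf Aboveᴾ) _ = tt
  act-∘W   (isPresheaf Aboveᴾ) _ _ _ = tt

  under : ∀ {F G P} → Aboveᴾ ×ᴾ F ⟶ G → Aboveᴾ ×ᴾ F ⁺ᴾ P ⟶ G ⁺ᴾ P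
  apply      (under α) = apply α
  apply-cong (under α) (_ , e) = apply-cong α (tt , e)
  natural    (under {P = P} α) f = natural α (extW P f)

  fresh : ∀ {F G a} → Aboveᴾ ×ᴾ Atomᴾ a ⟶ F → Aboveᴾ ×ᴾ (F ⊃ᴾ G) ⟶ G ⁺ᴾ (a ∷ [])
  apply      (fresh {a = a} ρ) {w} (n , η) =
    fun η (wkW (a ∷ [])) (apply ρ (n , lift (var (fresh∈ w a))))
  apply-cong (fresh {a = a} ρ) {w} {n , _} (_ , e) =
    e (wkW (a ∷ [])) (apply ρ (n , lift (var (fresh∈ w a))))
  natural    (fresh {F} {G} {a} ρ) {v} {w} f (n , η) =
    ≈-trans Ĝ (≡⇒≈ Ĝ (cong (λ k → fun η k (apply ρ (act (psh Aboveᴾ) f n , lift (var (fresh∈ v a)))))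
                            (wkW-natural (a ∷ []) f)))
      (≈-trans Ĝ (resp η (wkW (a ∷ []) ∘W extW (a ∷ []) f)
                   (≈-trans (isPresheaf F) (apply-cong ρ (tt , cong lift (sym (⟪extW⟫-fresh a f))))
                                           (natural ρ (extW (a ∷ []) f) (n , x))))
                 (nat η (wkW (a ∷ [])) (extW (a ∷ []) f) (apply ρ (n , x))))
    where
    Ĝ : IsPresheaf (psh G)
    Ĝ = isPresheaf G
    x : ∣ Atomᴾ a ∣ (w ⁺ (a ∷ []))
    x = lift (var (fresh∈ w a))

  Premises : List (List Atom × Atom) → Presheaf
  Premises []             = ⊤ᴾ
  Premises ((P , q) ∷ Ps) = Atomᴾ q ⁺ᴾ P ×ᴾ Premises Ps

  derivations : ∀ Ps {w} → ∣ Premises Ps ∣ w → Ders (base w) (ctx w) Ps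
  derivations []             _             = []
  derivations ((P , q) ∷ Ps) (lift d , ds) = d ∷ derivations Ps ds

  derivations-cong : ∀ Ps {w} {ds ds' : ∣ Premises Ps ∣ w} → _≈_ (psh (Premises Ps)) ds ds' →
                     derivations Ps ds ≡ derivations Ps ds'
  derivations-cong []       _          = refl
  derivations-cong (_ ∷ Ps) (refl , e) = cong (_ ∷_) (derivations-cong Ps e)

  derivations-act : ∀ Ps {v w} .(i : base w ⊆ base v) (σ : All (Der (base v) (ctx v)) (ctx w)) ds →
                    derivations Ps (act (psh (Premises Ps)) (hom i σ) ds)
                    ≡ subs i (All.lookup σ) (derivations Ps ds)
  derivations-act []             i σ _             = refl
  derivations-act ((P , q) ∷ Ps) i σ (lift d , ds) =
    cong₂ _∷_ (subHom-extW P i σ d) (derivations-act Ps i σ ds)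

  rule : ∀ R → .(N R) → Aboveᴾ ×ᴾ Premises (premises R) ⟶ Atomᴾ (conclusion R)
  apply      (rule R r) (above n , ds) = lift (app R (n R r) (derivations (premises R) ds))
  apply-cong (rule R r) {x = above n , _} (_ , e) =
    cong (λ ds → lift (app R (n R r) ds)) (derivations-cong (premises R) e)
  natural    (rule R r) (hom i σ) (above n , ds) =
    cong (λ ds → lift (app R (i R (n R r)) ds)) (derivations-act (premises R) i σ ds)

  rule₁ : ∀ {a c} → .(N (unary a c)) → Aboveᴾ ×ᴾ Atomᴾ a ⟶ Atomᴾ c
  rule₁ r = rule _ r ⊚ < weakenᴺ ∘ π₂ , ! >

  rule₂ : ∀ {a b c} → .(N (binary a b c)) → Aboveᴾ ×ᴾ (Atomᴾ a ×ᴾ Atomᴾ b) ⟶ Atomᴾ c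
  rule₂ r = rule _ r ⊚ < weakenᴺ ∘ π₁ ∘ π₂ , < weakenᴺ ∘ π₂ ∘ π₂ , ! > >

-- Sandqvist's simulation base

module Simulation (Γ : List Formula) (φ : Formula) where

  S : List Formula
  S = concatMap subformulas (φ ∷ Γ)

  S-closed : ∀ {χ θ} → χ ∈ S → θ ∈ subformulas χ → θ ∈ S
  S-closed χ∈ θ∈ with find (∈-concatMap⁻ subformulas {xs = φ ∷ Γ} χ∈)
  ... | ψ , ψ∈ , χ∈ψ = ∈-concatMap⁺ subformulas (lose ψ∈ (subformulas-trans ψ χ∈ψ θ∈))

  S-≺ : ∀ {a c} → c ∈ S → a ≺ c → a ∈ S
  S-≺ c∈ a≺c = S-closed c∈ (≺⇒∈-subformulas a≺c)

  φ∈S : φ ∈ S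
  φ∈S = ∈-concatMap⁺ subformulas {xs = φ ∷ Γ} (here (∈-subformulas φ))

  Γ⊆S : Γ ⊆ᶜ S
  Γ⊆S γ∈ = ∈-concatMap⁺ subformulas {xs = φ ∷ Γ} (there (lose γ∈ (∈-subformulas _)))

  -- atoms stand for themselves; compound formulas get fresh atoms above every atom of S
  flat : Formula → Atom
  flat (atom q) = q
  flat χ        = suc (atomBound S) + position χ S

  data FlatView : Formula → Set where
    atomic   : ∀ q → FlatView (atom q)
    compound : ∀ {χ} → flat χ ≡ suc (atomBound S) + position χ S → FlatView χ

  flatView : ∀ χ → FlatView χ
  flatView (atom q) = atomic q
  flatView ⊥′       = compound refl
  flatView (a ∧′ b) = compound refl
  flatView (a ∨′ b) = compound refl
  flatView (a ⊃′ b) = compound refl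

  atom≢compound : ∀ {q k} → atom q ∈ S → q ≢ suc (atomBound S) + k
  atom≢compound {k = k} q∈ e =
    <⇒≱ (s≤s (atomBound-≥ q∈)) (subst (suc (atomBound S) ≤_) (sym e) (m≤m+n _ k))

  flat-injective : ∀ {χ χ'} → χ ∈ S → χ' ∈ S → flat χ ≡ flat χ' → χ ≡ χ'
  flat-injective {χ} {χ'} χ∈ χ'∈ e with flatView χ | flatView χ'
  ... | atomic q    | atomic q'    = cong atom e
  ... | atomic q    | compound e'  = ⊥-elim (atom≢compound χ∈ (trans e e'))
  ... | compound e' | atomic q'    = ⊥-elim (atom≢compound χ'∈ (trans (sym e) e'))
  ... | compound e₁ | compound e₂  =
    position-injective χ∈ χ'∈ (+-cancelˡ-≡ _ _ _ (trans (sym e₁) (trans e e₂)))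

  -- The rules for ⊥ and ∨ are schematic in their conclusion q; testing membership
  -- at q = conclusion R keeps the base decidable.
  flatRules : Formula → Atom → List Rule
  flatRules (atom _) q = []
  flatRules ⊥′       q = unary (flat ⊥′) q ∷ []
  flatRules (a ∧′ b) q = binary (flat a) (flat b) (flat (a ∧′ b))
                       ∷ unary (flat (a ∧′ b)) (flat a)
                       ∷ unary (flat (a ∧′ b)) (flat b) ∷ []
  flatRules (a ∨′ b) q = unary (flat a) (flat (a ∨′ b))
                       ∷ unary (flat b) (flat (a ∨′ b))
                       ∷ ((([] , flat (a ∨′ b)) ∷ (flat a ∷ [] , q) ∷ (flat b ∷ [] , q) ∷ []) ⇒ q) ∷ []
  flatRules (a ⊃′ b) q = (((flat a ∷ [] , flat b) ∷ []) ⇒ flat (a ⊃′ b))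
                       ∷ binary (flat (a ⊃′ b)) (flat a) (flat b) ∷ []

  N : Base
  N R = R ∈ concatMap (λ χ → flatRules χ (conclusion R)) S

  N-intro : ∀ {χ R} → χ ∈ S → R ∈ flatRules χ (conclusion R) → N R
  N-intro χ∈ R∈ = ∈-concatMap⁺ _ {xs = S} (lose χ∈ R∈)

  -- Der records rule membership irrelevantly; decidability of N recovers it.
  N-recompute : ∀ R → .(N R) → N R
  N-recompute R = recompute (DecMembership._∈?_ _≟ᴿ_ R _)

  ⊩⇒⊢♭ : ∀ χ → χ ∈ S → ∀ C → N ⊆ C → ⊩[ C ] χ → [] ⊢[ C ] flat χ
  ⊢♭⇒⊩ : ∀ χ → χ ∈ S → ∀ C → N ⊆ C → [] ⊢[ C ] flat χ → ⊩[ C ] χ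
  -- Sandqvist's device: assume flat χ as an axiom of the base, then discharge it.
  hypothetical : ∀ χ {p} → χ ∈ S → ∀ C → N ⊆ C →
                 (∀ D → C ⊆ D → ⊩[ D ] χ → [] ⊢[ D ] p) → (flat χ ∷ []) ⊢[ C ] p
  ⊩⇒⊢♭ (atom q) s C n v = lower v
  ⊩⇒⊢♭ ⊥′       s C n v = lower (v (flat ⊥′))
  ⊩⇒⊢♭ (a ∧′ b) s C n (va , vb) =
    App _ (n _ (N-intro s (here refl)))
        (⊩⇒⊢♭ a (S-≺ s ∧ˡ) C n va ∷ ⊩⇒⊢♭ b (S-≺ s ∧ʳ) C n vb ∷ [])
  ⊩⇒⊢♭ (a ∨′ b) s C n v = lower (v (flat (a ∨′ b)) C ⊆-refl
    (λ D i va → lift (App _ (i _ (n _ (N-intro s (here refl))))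
                         (⊩⇒⊢♭ a (S-≺ s ∨ˡ) D (⊆-trans n i) va ∷ [])))
    (λ D i vb → lift (App _ (i _ (n _ (N-intro s (there (here refl)))))
                         (⊩⇒⊢♭ b (S-≺ s ∨ʳ) D (⊆-trans n i) vb ∷ []))))
  ⊩⇒⊢♭ (a ⊃′ b) s C n v =
    App _ (n _ (N-intro s (here refl)))
        (hypothetical a (S-≺ s ⊃ˡ) C n
          (λ D i va → ⊩⇒⊢♭ b (S-≺ s ⊃ʳ) D (⊆-trans n i) (v D i va)) ∷ [])
  ⊢♭⇒⊩ (atom q) s C n d = lift d
  ⊢♭⇒⊩ ⊥′       s C n d = λ p → lift (App _ (n _ (N-intro s (here refl))) (d ∷ []))
  ⊢♭⇒⊩ (a ∧′ b) s C n d =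
    ⊢♭⇒⊩ a (S-≺ s ∧ˡ) C n (App _ (n _ (N-intro s (there (here refl)))) (d ∷ [])) ,
    ⊢♭⇒⊩ b (S-≺ s ∧ʳ) C n (App _ (n _ (N-intro s (there (there (here refl))))) (d ∷ []))
  ⊢♭⇒⊩ (a ∨′ b) s C n d = λ p D i ka kb →
    lift (App _ (i _ (n _ (N-intro s (there (there (here refl))))))
      (⊢[]-mono i d
       ∷ hypothetical a (S-≺ s ∨ˡ) D (⊆-trans n i) (λ E j va → lower (ka E j va))
       ∷ hypothetical b (S-≺ s ∨ʳ) D (⊆-trans n i) (λ E j vb → lower (kb E j vb)) ∷ []))
  ⊢♭⇒⊩ (a ⊃′ b) s C n d = λ D i va →
    ⊢♭⇒⊩ b (S-≺ s ⊃ʳ) D (⊆-trans n i)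
      (App _ (i _ (n _ (N-intro s (there (here refl)))))
        (⊢[]-mono i d ∷ ⊩⇒⊢♭ a (S-≺ s ⊃ˡ) D (⊆-trans n i) va ∷ []))
  hypothetical χ s C n k =
    discharge (λ ()) (λ x → x)
      (k (C ⊕ (flat χ ∷ [])) ⊆-⊕ (⊢♭⇒⊩ χ s _ (⊆-trans n ⊆-⊕) (axiom (here refl))))

  ⊩⇒⊢[N] : Γ ⊩ φ → map flat Γ ⊢[ N ] flat φ
  ⊩⇒⊢[N] v = discharge (λ ()) (λ x → x) (⊩⇒⊢♭ φ φ∈S C ⊆-⊕ (v C (All.tabulate hypothesis)))
    where
    C : Base
    C = N ⊕ map flat Γ
    hypothesis : ∀ {γ} → γ ∈ Γ → ⊩[ C ] γ
    hypothesis γ∈ = ⊢♭⇒⊩ _ (Γ⊆S γ∈) C ⊆-⊕ (axiom (∈-map⁺ flat γ∈))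

  Represents : List Formula → List Atom → Set
  Represents Δ P = ∀ {a} → a ∈ P → ∃ λ δ → δ ∈ Δ × δ ∈ S × flat δ ≡ a

  represents-++[] : ∀ {Δ P} → Represents Δ P → Represents Δ (P ++ [])
  represents-++[] {P = P} r x with ∈-++⁻ P x
  ... | inj₁ y = r y

  represents-∷ : ∀ {Δ P α} → Represents Δ P → α ∈ S → Represents (α ∷ Δ) (P ++ flat α ∷ [])
  represents-∷ {P = P} r α∈ x with ∈-++⁻ P x
  ... | inj₁ y with r y
  ...   | δ , δ∈ , δ∈S , e = δ , there δ∈ , δ∈S , e
  represents-∷ r α∈ x | inj₂ (here refl) = _ , here refl , α∈ , refl

  representsΓ : Represents Γ (map flat Γ)
  representsΓ x with ∈-map⁻ flat x
  ... | γ , γ∈ , refl = γ , γ∈ , Γ⊆S γ∈ , refl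

  transport : ∀ {Δ χ θ} → χ ∈ S → θ ∈ S → flat χ ≡ flat θ → Δ ⊢ θ → Δ ⊢ χ
  transport χ∈ θ∈ e = subst (_ ⊢_) (sym (flat-injective χ∈ θ∈ e))

  ⊢[N]⇒⊢ : ∀ {P a} → P ⊢[ N ] a → ∀ {Δ χ} → χ ∈ S → Represents Δ P → flat χ ≡ a → Δ ⊢ χ
  ⊢[N]⇒⊢ (Ref x) s r e with r x
  ... | δ , δ∈ , δ∈S , e' = transport s δ∈S (trans e (sym e')) (hyp δ∈)
  ⊢[N]⇒⊢ (App (ps ⇒ q) m ds) s r e with find (∈-concatMap⁻ _ {xs = S} m)
  ... | atom _ , _ , ()
  ⊢[N]⇒⊢ (App _ _ (d ∷ [])) {χ = χ} s r e | ⊥′ , s₀ , here refl =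
    ⊥-elim′ χ (⊢[N]⇒⊢ d s₀ (represents-++[] r) refl)
  ⊢[N]⇒⊢ (App _ _ (d₁ ∷ d₂ ∷ [])) s r e | (a ∧′ b) , s₀ , here refl =
    transport s s₀ e (∧I (⊢[N]⇒⊢ d₁ (S-≺ s₀ ∧ˡ) (represents-++[] r) refl)
                         (⊢[N]⇒⊢ d₂ (S-≺ s₀ ∧ʳ) (represents-++[] r) refl))
  ⊢[N]⇒⊢ (App _ _ (d ∷ [])) s r e | (a ∧′ b) , s₀ , there (here refl) =
    transport s (S-≺ s₀ ∧ˡ) e (∧E₁ (⊢[N]⇒⊢ d s₀ (represents-++[] r) refl))
  ⊢[N]⇒⊢ (App _ _ (d ∷ [])) s r e | (a ∧′ b) , s₀ , there (there (here refl)) =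
    transport s (S-≺ s₀ ∧ʳ) e (∧E₂ (⊢[N]⇒⊢ d s₀ (represents-++[] r) refl))
  ⊢[N]⇒⊢ (App _ _ (d ∷ [])) s r e | (a ∨′ b) , s₀ , here refl =
    transport s s₀ e (∨I₁ (⊢[N]⇒⊢ d (S-≺ s₀ ∨ˡ) (represents-++[] r) refl))
  ⊢[N]⇒⊢ (App _ _ (d ∷ [])) s r e | (a ∨′ b) , s₀ , there (here refl) =
    transport s s₀ e (∨I₂ (⊢[N]⇒⊢ d (S-≺ s₀ ∨ʳ) (represents-++[] r) refl))
  ⊢[N]⇒⊢ (App _ _ (d₀ ∷ d₁ ∷ d₂ ∷ [])) {χ = χ} s r e | (a ∨′ b) , s₀ , there (there (here refl)) =
    ∨-elim χ (⊢[N]⇒⊢ d₀ s₀ (represents-++[] r) refl)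
             (⊢[N]⇒⊢ d₁ s (represents-∷ r (S-≺ s₀ ∨ˡ)) e)
             (⊢[N]⇒⊢ d₂ s (represents-∷ r (S-≺ s₀ ∨ʳ)) e)
  ⊢[N]⇒⊢ (App _ _ (d ∷ [])) s r e | (a ⊃′ b) , s₀ , here refl =
    transport s s₀ e (⊃I (⊢[N]⇒⊢ d (S-≺ s₀ ⊃ʳ) (represents-∷ r (S-≺ s₀ ⊃ˡ)) refl))
  ⊢[N]⇒⊢ (App _ _ (d₁ ∷ d₂ ∷ [])) s r e | (a ⊃′ b) , s₀ , there (here refl) =
    transport s (S-≺ s₀ ⊃ʳ) e (⊃E (⊢[N]⇒⊢ d₁ s₀ (represents-++[] r) refl)
                                  (⊢[N]⇒⊢ d₂ (S-≺ s₀ ⊃ˡ) (represents-++[] r) refl))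

  ⊩⇒⊢ : Γ ⊩ φ → Γ ⊢ φ
  ⊩⇒⊢ v = ⊢[N]⇒⊢ (⊩⇒⊢[N] v) φ∈S representsΓ refl

  open Over N

  reflect : ∀ χ → χ ∈ S → Aboveᴾ ×ᴾ Atomᴾ (flat χ) ⟶ ⟦ χ ⟧ᴾ
  reify   : ∀ χ → χ ∈ S → Aboveᴾ ×ᴾ ⟦ χ ⟧ᴾ ⟶ Atomᴾ (flat χ)
  reflect (atom q) s = π₂
  reflect ⊥′       s = tabulateΠ (λ p → rule₁ (N-intro s (here refl)))
  reflect (a ∧′ b) s =
    < reflect a (S-≺ s ∧ˡ) ⊚ rule₁ (N-intro s (there (here refl)))
    , reflect b (S-≺ s ∧ʳ) ⊚ rule₁ (N-intro s (there (there (here refl)))) >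
  reflect (a ∨′ b) s = tabulateΠ λ p → Λ (Λ (rule _ (N-intro s (there (there (here refl))))
    ⊚ < weakenᴺ ∘ π₁ ∘ π₁ ∘ π₂
      , < fresh {G = Atomᴾ p} (reflect a (S-≺ s ∨ˡ)) ⊚ (π₂ ∘ π₁ ∘ π₂)
        , < fresh {G = Atomᴾ p} (reflect b (S-≺ s ∨ʳ)) ⊚ (π₂ ∘ π₂) , ! > > >))
  reflect (a ⊃′ b) s = Λ (reflect b (S-≺ s ⊃ʳ) ⊚ rule₂ (N-intro s (there (here refl)))
    ⊚ < π₁ ∘ π₂ , reify a (S-≺ s ⊃ˡ) ⊚ (π₂ ∘ π₂) >)
  reify (atom q) s = π₂
  reify ⊥′       s = projΠ {G = Atomᴾ} (flat ⊥′) ∘ π₂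
  reify (a ∧′ b) s = rule₂ (N-intro s (here refl))
    ⊚ < reify a (S-≺ s ∧ˡ) ⊚ (π₁ ∘ π₂) , reify b (S-≺ s ∧ʳ) ⊚ (π₂ ∘ π₂) >
  reify (a ∨′ b) s = (projΠ {G = ∨-eliminatorᴾ a b} (flat (a ∨′ b)) ∘ π₂)
    · Λ (rule₁ (N-intro s (here refl)) ⊚ reify a (S-≺ s ∨ˡ) ⊚ (π₂ ∘ π₂))
    · Λ (rule₁ (N-intro s (there (here refl))) ⊚ reify b (S-≺ s ∨ʳ) ⊚ (π₂ ∘ π₂))
  reify (a ⊃′ b) s = rule _ (N-intro s (here refl))
    ⊚ < under (reify b (S-≺ s ⊃ʳ)) ⊚ fresh {G = ⟦ b ⟧ᴾ} (reflect a (S-≺ s ⊃ˡ)) , ! >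

  Der⇒⊢[] : ∀ {P a} → Der N P a → P ⊢[ N ] a
  Ders⇒⊢[] : ∀ {P Ps} → Ders N P Ps → All (λ Pq → (P ++ proj₁ Pq) ⊢[ N ] proj₂ Pq) Ps
  Der⇒⊢[] (var x)      = Ref x
  Der⇒⊢[] (app R r ds) = App R (N-recompute R r) (Ders⇒⊢[] ds)
  Ders⇒⊢[] []       = []
  Ders⇒⊢[] (d ∷ ds) = Der⇒⊢[] d ∷ Ders⇒⊢[] ds

  generic : ∀ {γ} → γ ∈ Γ → ∣ ⟦ γ ⟧ᴾ ∣ ⟨ N , map flat Γ ⟩
  generic γ∈ = apply (reflect _ (Γ⊆S γ∈)) (above ⊆-refl , lift (var (∈-map⁺ flat γ∈)))

  ⊨⇒⊢ : Γ ⊨ φ → Γ ⊢ φ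
  ⊨⇒⊢ ν = ⊢[N]⇒⊢ (Der⇒⊢[] (lower derivation)) φ∈S representsΓ refl
    where
    derivation : ∣ Atomᴾ (flat φ) ∣ ⟨ N , map flat Γ ⟩
    derivation = apply (reify φ φ∈S)
                       (above ⊆-refl , NatTrans.η ν (⟦⟧*-fromAll (All.tabulate generic)))

proposition9 : (Γ : List Formula) (φ : Formula) → (Γ ⊩ φ) ⇔ (Γ ⊨ φ)
proposition9 Γ φ = mk⇔ (λ v → toNatTrans (⊢⇒⊨ (⊩⇒⊢ v))) (λ ν → ⊢⇒⊩ (⊨⇒⊢ ν))
  where open Simulation Γ φ
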